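{- Let $\mathcal{H}$ be a hypergraph, let $\mathcal{H}'$ be a subhypergraph of $\mathcal{H}$ (i.e. $V(\mathcal{H}') \subseteq V(\mathcal{H})$ and $E(\mathcal{H}') \subseteq E(\mathcal{H})$), and let $a,b \in \mathbb{Z}_+$. If Maker wins the $(a,b)$-game on $\mathcal{H}'$, then Maker wins the $(a,b)$-game on $\mathcal{H}$.
   Context: A hypergraph $\mathcal{H}$ consists of a finite vertex set $V(\mathcal{H})$ and a set $E(\mathcal{H})$ of subsets of $V(\mathcal{H})$ (edges). For $a,b$ (nonnegative integers or the symbol $\ast$, meaning an unlimited supply, i.e. enough tokens to use a new one on every turn), the $(a,b)$-game on $\mathcal{H}$ is played as follows: Maker has $a$ tokens and Breaker has $b$ tokens; initially no token is on the board. The players alternate turns, Maker first. On a turn a player may pass, or place one of their own tokens on an unoccupied vertex, where the token is either one not yet used or one already on the board that is moved from its current vertex (which then becomes unoccupied). Maker wins as soon as all vertices of some edge carry Maker tokens. Breaker wins if this never happens, or if the game reaches the same state (placement of all tokens and player to move) twice. "Maker wins the game" means Maker has a winning strategy; otherwise Breaker has one. -}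

module Defs where

open import Data.Nat using (ℕ; _<_)
open import Data.Fin using (Fin)
open import Data.Fin.Subset using (Subset; _∈_; _∉_; _⊆_; _∪_; _-_; ⁅_⁆; ∣_∣; ⊥)
open import Data.List using (List; []; _∷_)
open import Data.List.Relation.Unary.Any using (Any)
open import Data.Product using (Σ; _×_; _,_)
open import Relation.Binary.PropositionalEquality using (_≡_)
open import Relation.Nullary using (¬_)

record Hypergraph (N : ℕ) : Set where
  field
    V       : Subset N
    E       : List (Subset N)
    edges⊆V : ∀ {e} → Any (e ≡_) E → e ⊆ V
open Hypergraph public

record SubHypergraph {N : ℕ} (H' H : Hypergraph N) : Set where
  field
    V⊆ : V H' ⊆ V H
    E⊆ : ∀ {e} → Any (e ≡_) (E H') → Any (e ≡_) (E H)

data Player : Set where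
  maker breaker : Player

-- A game state: the set of vertices carrying Maker tokens, the set of
-- vertices carrying Breaker tokens, and the player to move.
-- (Tokens of one player are interchangeable; unused tokens are
-- determined by the counts.)
record State (N : ℕ) : Set where
  constructor st
  field
    mk   : Subset N
    bk   : Subset N
    turn : Player
open State public

initial : ∀ {N} → State N
initial = st ⊥ ⊥ maker

data Move {N : ℕ} (H : Hypergraph N) (a b : ℕ) : State N → State N → Set where
  passM  : ∀ {M B} → Move H a b (st M B maker) (st M B breaker)
  passB  : ∀ {M B} → Move H a b (st M B breaker) (st M B maker)
  placeM : ∀ {M B} v → v ∈ V H → v ∉ M → v ∉ B → ∣ M ∣ < a →
           Move H a b (st M B maker) (st (M ∪ ⁅ v ⁆) B breaker)
  placeB : ∀ {M B} v → v ∈ V H → v ∉ M → v ∉ B → ∣ B ∣ < b →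
           Move H a b (st M B breaker) (st M (B ∪ ⁅ v ⁆) maker)
  shiftM : ∀ {M B} u v → u ∈ M → v ∈ V H → v ∉ M → v ∉ B →
           Move H a b (st M B maker) (st ((M - u) ∪ ⁅ v ⁆) B breaker)
  shiftB : ∀ {M B} u v → u ∈ B → v ∈ V H → v ∉ M → v ∉ B →
           Move H a b (st M B breaker) (st M ((B - u) ∪ ⁅ v ⁆) maker)

MakerFilled : ∀ {N} → Hypergraph N → State N → Set
MakerFilled H s = Σ _ λ e → Any (e ≡_) (E H) × e ⊆ mk s

-- Breaker wins if a
-- state is reached a second time; since the play is then bounded in length,
-- the inductive (well-founded) definition captures winning strategies.
data Win {N : ℕ} (H : Hypergraph N) (a b : ℕ) (hist : List (State N)) :
         State N → Set where
  won     : ∀ {s} → MakerFilled H s → Win H a b hist s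
  makerTo : ∀ {s} → turn s ≡ maker → ¬ Any (s ≡_) hist →
            (Σ _ λ s' → Move H a b s s' × Win H a b (s ∷ hist) s') →
            Win H a b hist s
  breakerTo : ∀ {s} → turn s ≡ breaker → ¬ Any (s ≡_) hist →
            (∀ s' → Move H a b s s' → Win H a b (s ∷ hist) s') →
            Win H a b hist s

MakerWins : ∀ {N} → Hypergraph N → ℕ → ℕ → Set
MakerWins H a b = Win H a b [] initial

{-# OPTIONS --safe #-}
module Submission where

-- Maker plays her winning strategy for H′ on H against a shadow Breaker on H′ whose tokens cover
-- every real Breaker token inside V(H′); real Breaker moves are answered by shadow moves onto the
-- same vertex, or by shadow passes outside V(H′). A real play may repeat a state while the shadow
-- play does not, so the argument goes through the history-free Forces n s ("Maker can complete an
-- edge from s within n moves"): on a finite board a win with repetition rule gives a forcing of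
-- bounded rank (count the unvisited states), forcings lift from H′ to H, and a forcing turns back
-- into a win because following one of least rank never repeats a state.

open import Defs
import Data.Bool.Properties as Bool
open import Data.Fin.Base using (Fin)
import Data.Fin.Properties as Fin
open import Data.Fin.Subset
  using (Subset; inside; outside; _∈_; _∉_; _⊆_; _⊂_; _∪_; _∩_; _-_; ⁅_⁆; ∣_∣; ⊥)
open import Data.Fin.Subset.Properties
  using (_∈?_; _⊆?_; ∣p∣≤∣x∷p∣; ∣⊥∣≡0; ∣⁅x⁆∣≡1; p⊂q⇒∣p∣<∣q∣; x∈p⇒∣p-x∣<∣p∣; ∉⊥; x∈⁅x⁆; x∈⁅y⁆⇒x≡y;
         p⊆p∪q; q⊆p∪q; x∈p∪q⁻; x∈p∩q⁺; x∈p∩q⁻; p─q⊆p; x∈p∧x≢y⇒x∈p-y)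
open import Data.List.Base using (List; []; _∷_; _++_; map; length; cartesianProductWith)
import Data.List.Countdown as Countdown
open import Data.List.Membership.Propositional using (find; lose) renaming (_∈_ to _∈ₗ_; _∉_ to _∉ₗ_)
open import Data.List.Membership.Propositional.Properties
  using (∈-map⁺; ∈-++⁺ˡ; ∈-++⁺ʳ; ∈-cartesianProductWith⁺)
open import Data.List.Relation.Unary.All as All using (All; []; _∷_)
open import Data.List.Relation.Unary.Any using (here; there; any?)
open import Data.Nat.Base using (ℕ; zero; suc; _≤_; _<_; _+_; z≤n; s≤s)
open import Data.Nat.Induction using (<-wellFounded)
open import Data.Nat.Properties
  using (_<?_; ≤-refl; ≤-trans; ≤-reflexive; ≤-pred; m≤n⇒m≤1+n; <-≤-trans; +-suc; +-comm; +-monoʳ-≤)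
open import Data.Product using (∃; _×_; _,_; proj₁)
open import Data.Sum using (_⊎_; inj₁; inj₂; [_,_])
open import Data.Vec.Base using ([]; _∷_)
import Data.Vec.Properties as Vec
open import Function.Base using (_∘_; _$_; id)
open import Induction.WellFounded using (Acc; acc)
open import Relation.Binary.Definitions using (DecidableEquality)
open import Relation.Binary.PropositionalEquality using (_≡_; _≢_; refl; sym; trans; cong)
open import Relation.Binary.PropositionalEquality.Properties using (decSetoid)
open import Relation.Nullary using (¬_; Dec; yes; no; contradiction)
open import Relation.Nullary.Decidable using (map′; _×-dec_; _⊎-dec_; _→-dec_; ¬?; decidable-stable)
open import Relation.Unary using (Decidable)

∣p∪q∣≤∣p∣+∣q∣ : ∀ {n} (p q : Subset n) → ∣ p ∪ q ∣ ≤ ∣ p ∣ + ∣ q ∣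
∣p∪q∣≤∣p∣+∣q∣ []            []            = z≤n
∣p∪q∣≤∣p∣+∣q∣ (inside  ∷ p) (y       ∷ q) =
  s≤s (≤-trans (∣p∪q∣≤∣p∣+∣q∣ p q) (+-monoʳ-≤ ∣ p ∣ (∣p∣≤∣x∷p∣ y q)))
∣p∪q∣≤∣p∣+∣q∣ (outside ∷ p) (inside  ∷ q) =
  ≤-trans (s≤s (∣p∪q∣≤∣p∣+∣q∣ p q)) (≤-reflexive (sym (+-suc ∣ p ∣ ∣ q ∣)))
∣p∪q∣≤∣p∣+∣q∣ (outside ∷ p) (outside ∷ q) = ∣p∪q∣≤∣p∣+∣q∣ p q

∣p∪⁅x⁆∣≤1+∣p∣ : ∀ {n} (p : Subset n) x → ∣ p ∪ ⁅ x ⁆ ∣ ≤ suc ∣ p ∣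
∣p∪⁅x⁆∣≤1+∣p∣ p x = ≤-trans (∣p∪q∣≤∣p∣+∣q∣ p ⁅ x ⁆)
  (≤-reflexive (trans (cong (∣ p ∣ +_) (∣⁅x⁆∣≡1 x)) (+-comm ∣ p ∣ 1)))

module _ {p} {P : ℕ → Set p} (P? : Decidable P) (P-mono : ∀ {m n} → m ≤ n → P m → P n) where

  leastWitness : ∀ {n} → P n → ∃ λ k → k ≤ n × P k × (∀ {j} → j < k → ¬ P j)
  leastWitness {zero}  pn = 0 , z≤n , pn , λ ()
  leastWitness {suc n} pn with P? n
  ... | yes pn′ = let k , k≤n , pk , least = leastWitness pn′ in k , m≤n⇒m≤1+n k≤n , pk , least
  ... | no ¬pn′ = suc n , ≤-refl , pn , λ j<1+n pj → ¬pn′ (P-mono (≤-pred j<1+n) pj)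

allSubsets : ∀ n → List (Subset n)
allSubsets zero    = [] ∷ []
allSubsets (suc n) = map (inside ∷_) (allSubsets n) ++ map (outside ∷_) (allSubsets n)

∈-allSubsets : ∀ {n} (p : Subset n) → p ∈ₗ allSubsets n
∈-allSubsets []            = here refl
∈-allSubsets (inside  ∷ p) = ∈-++⁺ˡ (∈-map⁺ (inside ∷_) (∈-allSubsets p))
∈-allSubsets (outside ∷ p) = ∈-++⁺ʳ _ (∈-map⁺ (outside ∷_) (∈-allSubsets p))

allStates : ∀ N → List (State N)
allStates N = cartesianProductWith _$_
  (cartesianProductWith st (allSubsets N) (allSubsets N)) (maker ∷ breaker ∷ [])

∈-allStates : ∀ {N} (s : State N) → s ∈ₗ allStates N
∈-allStates (st M B t) = ∈-cartesianProductWith⁺ _$_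
  (∈-cartesianProductWith⁺ st (∈-allSubsets M) (∈-allSubsets B)) (∈-players t)
  where
  ∈-players : ∀ t → t ∈ₗ maker ∷ breaker ∷ []
  ∈-players maker   = here refl
  ∈-players breaker = there (here refl)

_≟ₚ_ : DecidableEquality Player
maker   ≟ₚ maker   = yes refl
maker   ≟ₚ breaker = no λ ()
breaker ≟ₚ maker   = no λ ()
breaker ≟ₚ breaker = yes refl

_≟ₛ_ : ∀ {N} → DecidableEquality (State N)
st M B t ≟ₛ st M′ B′ t′ = map′ (λ { (refl , refl , refl) → refl }) (λ { refl → refl , refl , refl })
  (Vec.≡-dec Bool._≟_ M M′ ×-dec Vec.≡-dec Bool._≟_ B B′ ×-dec t ≟ₚ t′)

data Forces {N : ℕ} (H : Hypergraph N) (a b : ℕ) : ℕ → State N → Set where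
  filled         : ∀ {n s} → MakerFilled H s → Forces H a b n s
  makerMove      : ∀ {n M B} → (∃ λ s′ → Move H a b (st M B maker) s′ × Forces H a b n s′) →
                   Forces H a b (suc n) (st M B maker)
  breakerReplies : ∀ {n M B} → (∀ s′ → Move H a b (st M B breaker) s′ → Forces H a b n s′) →
                   Forces H a b (suc n) (st M B breaker)

module _ {N : ℕ} (H : Hypergraph N) (a b : ℕ) where

  Forces-mono : ∀ {m n s} → m ≤ n → Forces H a b m s → Forces H a b n s
  Forces-mono _         (filled f)                 = filled f
  Forces-mono (s≤s m≤n) (makerMove (s′ , mv , p)) = makerMove (s′ , mv , Forces-mono m≤n p)
  Forces-mono (s≤s m≤n) (breakerReplies p)         = breakerReplies λ s′ mv → Forces-mono m≤n (p s′ mv)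

  makerFilled? : ∀ s → Dec (MakerFilled H s)
  makerFilled? s = map′ find (λ (e , e∈E , e⊆M) → lose e∈E e⊆M) (any? (_⊆? mk s) (E H))

  module _ {p} {P : State N → Set p} (P? : Decidable P) where

    private
      vacant? : ∀ M B v → Dec (v ∈ V H × v ∉ M × v ∉ B)
      vacant? M B v = v ∈? V H ×-dec ¬? (v ∈? M) ×-dec ¬? (v ∈? B)

    someMakerMove? : ∀ M B → Dec (∃ λ s′ → Move H a b (st M B maker) s′ × P s′)
    someMakerMove? M B = map′
      (λ { (inj₁ p) → _ , passM , p
         ; (inj₂ (inj₁ (v , (v∈V , v∉M , v∉B) , ∣M∣<a , p))) → _ , placeM v v∈V v∉M v∉B ∣M∣<a , p
         ; (inj₂ (inj₂ (u , v , u∈M , (v∈V , v∉M , v∉B) , p))) → _ , shiftM u v u∈M v∈V v∉M v∉B , p })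
      (λ { (_ , passM , p) → inj₁ p
         ; (_ , placeM v v∈V v∉M v∉B ∣M∣<a , p) → inj₂ (inj₁ (v , (v∈V , v∉M , v∉B) , ∣M∣<a , p))
         ; (_ , shiftM u v u∈M v∈V v∉M v∉B , p) → inj₂ (inj₂ (u , v , u∈M , (v∈V , v∉M , v∉B) , p)) })
      (P? (st M B breaker)
        ⊎-dec Fin.any? (λ v → vacant? M B v ×-dec ∣ M ∣ <? a ×-dec P? (st (M ∪ ⁅ v ⁆) B breaker))
        ⊎-dec Fin.any? (λ u → Fin.any? λ v →
                u ∈? M ×-dec vacant? M B v ×-dec P? (st ((M - u) ∪ ⁅ v ⁆) B breaker)))

    everyBreakerMove? : ∀ M B → Dec (∀ s′ → Move H a b (st M B breaker) s′ → P s′)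
    everyBreakerMove? M B = map′
      (λ { (p , _ , _) _ passB → p
         ; (_ , p , _) _ (placeB v v∈V v∉M v∉B ∣B∣<b) → p v ((v∈V , v∉M , v∉B) , ∣B∣<b)
         ; (_ , _ , p) _ (shiftB u v u∈B v∈V v∉M v∉B) → p u v (u∈B , (v∈V , v∉M , v∉B)) })
      (λ p → p _ passB
           , (λ v ((v∈V , v∉M , v∉B) , ∣B∣<b) → p _ (placeB v v∈V v∉M v∉B ∣B∣<b))
           , (λ u v (u∈B , (v∈V , v∉M , v∉B)) → p _ (shiftB u v u∈B v∈V v∉M v∉B)))
      (P? (st M B maker)
        ×-dec Fin.all? (λ v → (vacant? M B v ×-dec ∣ B ∣ <? b) →-dec P? (st M (B ∪ ⁅ v ⁆) maker))
        ×-dec Fin.all? (λ u → Fin.all? λ v →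
                (u ∈? B ×-dec vacant? M B v) →-dec P? (st M ((B - u) ∪ ⁅ v ⁆) maker)))

  forces? : ∀ n s → Dec (Forces H a b n s)
  forces? zero    s                = map′ filled (λ { (filled f) → f }) (makerFilled? s)
  forces? (suc n) s@(st M B maker) = map′ [ filled , makerMove ]
    (λ { (filled f) → inj₁ f ; (makerMove m) → inj₂ m })
    (makerFilled? s ⊎-dec someMakerMove? (forces? n) M B)
  forces? (suc n) s@(st M B breaker) = map′ [ filled , breakerReplies ]
    (λ { (filled f) → inj₁ f ; (breakerReplies r) → inj₂ r })
    (makerFilled? s ⊎-dec everyBreakerMove? (forces? n) M B)

  leastForcing : ∀ {n s} → Forces H a b n s →
                 ∃ λ k → k ≤ n × Forces H a b k s × (∀ {j} → j < k → ¬ Forces H a b j s)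
  leastForcing {s = s} = leastWitness (λ n → forces? n s) Forces-mono

  mutual
    forces⇒wins : ∀ {k hist s} → Acc _<_ k →
                  Forces H a b k s → (∀ {j} → j < k → ¬ Forces H a b j s) →
                  All (¬_ ∘ Forces H a b k) hist → Win H a b hist s
    forces⇒wins _ (filled f) _ _ = won f
    forces⇒wins rec p@(makerMove (s′ , mv , p′)) least unforced =
      makerTo refl (λ s∈ → All.lookup unforced s∈ p)
        (s′ , mv , forces⇒wins-next rec least unforced p′)
    forces⇒wins rec p@(breakerReplies r) least unforced =
      breakerTo refl (λ s∈ → All.lookup unforced s∈ p)
        (λ s′ mv → forces⇒wins-next rec least unforced (r s′ mv))

    forces⇒wins-next : ∀ {k hist s s′} → Acc _<_ (suc k) → (∀ {j} → j < suc k → ¬ Forces H a b j s) →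
                       All (¬_ ∘ Forces H a b (suc k)) hist →
                       Forces H a b k s′ → Win H a b (s ∷ hist) s′
    forces⇒wins-next (acc rs) least unforced p′ with leastForcing p′
    ... | j , j≤k , q , least′ =
      forces⇒wins (rs (s≤s j≤k)) q least′
        (least (s≤s j≤k) ∷ All.map (_∘ Forces-mono (m≤n⇒m≤1+n j≤k)) unforced)

  forces⇒makerWins : ∀ {n} → Forces H a b n initial → MakerWins H a b
  forces⇒makerWins p with leastForcing p
  ... | k , _ , q , least = forces⇒wins (<-wellFounded k) q least []

module _ {N : ℕ} (H : Hypergraph N) (a b : ℕ) where
  open Countdown (decSetoid (_≟ₛ_ {N})) using (_⊕_; emptyFromList; lookupOrInsert)

  countVisit : ∀ {hist n s} → hist ⊕ n → s ∉ₗ hist → ∃ λ m → n ≡ suc m × s ∷ hist ⊕ m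
  countVisit {s = s} c s∉ = [ (λ s∈ → contradiction s∈ s∉) , id ] (lookupOrInsert c s)

  wins⇒forces : ∀ {hist n s} → hist ⊕ n → Win H a b hist s → Forces H a b n s
  wins⇒forces c (won f) = filled f
  wins⇒forces c (makerTo refl s∉ (s′ , mv , w)) with countVisit c s∉
  ... | _ , refl , c′ = makerMove (s′ , mv , wins⇒forces c′ w)
  wins⇒forces c (breakerTo refl s∉ r) with countVisit c s∉
  ... | _ , refl , c′ = breakerReplies λ s′ mv → wins⇒forces c′ (r s′ mv)

  makerWins⇒forces : MakerWins H a b → Forces H a b (length (allStates N)) initial
  makerWins⇒forces = wins⇒forces (emptyFromList (allStates N) ∈-allStates)

module _ {N : ℕ} {H H′ : Hypergraph N} {a b : ℕ} (sub : SubHypergraph H′ H) where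
  open SubHypergraph sub

  private
    cover : ∀ {B S W : Subset N} {v} →
            (v ∈ W → v ∈ S) → (∀ {x} → x ≢ v → x ∈ B → x ∈ W → x ∈ S) → B ∩ W ⊆ S
    cover {B} {W = W} {v} v-covered others-covered {x} x∈B∩W with x∈p∩q⁻ B W x∈B∩W | x Fin.≟ v
    ... | _ , x∈W | yes refl = v-covered x∈W
    ... | x∈B , x∈W | no x≢v = others-covered x≢v x∈B x∈W

    uncovered⇒∉ : ∀ {B S v} → B ∩ V H′ ⊆ S → v ∈ V H′ → v ∉ S → v ∉ B
    uncovered⇒∉ covered v∈V v∉S v∈B = v∉S (covered (x∈p∩q⁺ (v∈B , v∈V)))

  -- After Breaker puts a token on v in H, the shadow Breaker in H′ answers by moving a shadow
  -- token not needed to cover B onto v, or by placing a fresh one if there is none: then S ⊂ B.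
  shadowReply : ∀ {M B S} v → v ∈ B → v ∉ M → ∣ B ∣ ≤ b →
                (∀ {x} → x ≢ v → x ∈ B → x ∈ V H′ → x ∈ S) →
                ∃ λ S′ → Move H′ a b (st M S breaker) (st M S′ maker) × B ∩ V H′ ⊆ S′
  shadowReply {B = B} {S} v v∈B v∉M ∣B∣≤b others with v ∈? V H′ | v ∈? S
  ... | no v∉V | _ = S , passB , cover (λ v∈V → contradiction v∈V v∉V) others
  ... | yes _ | yes v∈S = S , passB , cover (λ _ → v∈S) others
  ... | yes v∈V | no v∉S with Fin.any? (λ y → y ∈? S ×-dec ¬? (y ∈? B))
  ...   | yes (y , y∈S , y∉B) = (S - y) ∪ ⁅ v ⁆ , shiftB y v y∈S v∈V v∉M v∉S ,
          cover (λ _ → q⊆p∪q (S - y) ⁅ v ⁆ (x∈⁅x⁆ v))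
                (λ x≢v x∈B x∈V → p⊆p∪q ⁅ v ⁆ (x∈p∧x≢y⇒x∈p-y (others x≢v x∈B x∈V) λ { refl → y∉B x∈B }))
  ...   | no noSpare = S ∪ ⁅ v ⁆ , placeB v v∈V v∉M v∉S (<-≤-trans (p⊂q⇒∣p∣<∣q∣ S⊂B) ∣B∣≤b) ,
          cover (λ _ → q⊆p∪q S ⁅ v ⁆ (x∈⁅x⁆ v)) (λ x≢v x∈B x∈V → p⊆p∪q ⁅ v ⁆ (others x≢v x∈B x∈V))
    where
    S⊂B : S ⊂ B
    S⊂B = (λ {x} x∈S → decidable-stable (x ∈? B) λ x∉B → noSpare (x , x∈S , x∉B)) , v , v∈B , v∉S

  liftForces : ∀ {n M B S t} → Forces H′ a b n (st M S t) → B ∩ V H′ ⊆ S → ∣ B ∣ ≤ b →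
               Forces H a b n (st M B t)
  liftForces (filled (e , e∈E , e⊆M)) _ _ = filled (e , E⊆ e∈E , e⊆M)
  liftForces (makerMove (_ , passM , p)) covered ∣B∣≤b =
    makerMove (_ , passM , liftForces p covered ∣B∣≤b)
  liftForces (makerMove (_ , placeM v v∈V v∉M v∉S ∣M∣<a , p)) covered ∣B∣≤b =
    makerMove (_ , placeM v (V⊆ v∈V) v∉M (uncovered⇒∉ covered v∈V v∉S) ∣M∣<a ,
               liftForces p covered ∣B∣≤b)
  liftForces (makerMove (_ , shiftM u v u∈M v∈V v∉M v∉S , p)) covered ∣B∣≤b =
    makerMove (_ , shiftM u v u∈M (V⊆ v∈V) v∉M (uncovered⇒∉ covered v∈V v∉S) ,
               liftForces p covered ∣B∣≤b)
  liftForces {suc n} {M} {B} {S} (breakerReplies r) covered ∣B∣≤b = breakerReplies λ where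
      _ passB                    → liftForces (r _ passB) covered ∣B∣≤b
      _ (placeB _ _ v∉M _ ∣B∣<b) → afterBreakerPut id ∣B∣<b v∉M
      _ (shiftB u _ u∈B _ v∉M _) →
        afterBreakerPut (p─q⊆p B ⁅ u ⁆) (<-≤-trans (x∈p⇒∣p-x∣<∣p∣ u∈B) ∣B∣≤b) v∉M
    where
    afterBreakerPut : ∀ {X v} → X ⊆ B → ∣ X ∣ < b → v ∉ M → Forces H a b n (st M (X ∪ ⁅ v ⁆) maker)
    afterBreakerPut {X} {v} X⊆B ∣X∣<b v∉M =
      let _ , mv , covered′ = shadowReply v (q⊆p∪q X ⁅ v ⁆ (x∈⁅x⁆ v)) v∉M ∣X∪v∣≤b others
      in liftForces (r _ mv) covered′ ∣X∪v∣≤b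
      where
      ∣X∪v∣≤b : ∣ X ∪ ⁅ v ⁆ ∣ ≤ b
      ∣X∪v∣≤b = ≤-trans (∣p∪⁅x⁆∣≤1+∣p∣ X v) ∣X∣<b
      others : ∀ {x} → x ≢ v → x ∈ X ∪ ⁅ v ⁆ → x ∈ V H′ → x ∈ S
      others x≢v x∈X∪v x∈V with x∈p∪q⁻ X ⁅ v ⁆ x∈X∪v
      ... | inj₁ x∈X = covered (x∈p∩q⁺ (X⊆B x∈X , x∈V))
      ... | inj₂ x∈v = contradiction (x∈⁅y⁆⇒x≡y v x∈v) x≢v

proposition2p2 : ∀ {N : ℕ} (H H' : Hypergraph N) (a b : ℕ) →
    SubHypergraph H' H → MakerWins H' a b → MakerWins H a b
proposition2p2 {N} H H' a b sub wins′ =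
  forces⇒makerWins H a b (liftForces sub (makerWins⇒forces H' a b wins′) nothingToCover ∣⊥∣≤b)
  where
  nothingToCover : ⊥ ∩ V H' ⊆ ⊥
  nothingToCover x∈⊥∩V = contradiction (proj₁ (x∈p∩q⁻ ⊥ (V H') x∈⊥∩V)) ∉⊥
  ∣⊥∣≤b : ∣ ⊥ {N} ∣ ≤ b
  ∣⊥∣≤b = ≤-trans (≤-reflexive (∣⊥∣≡0 N)) z≤n
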